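{- Let $k\ge 2$ and $i\in\{1,\dots,k-1\}$, and let $\lambda_0,\dots,\lambda_k$ be the eigenvalues of $J(2k,k,i)$, $\lambda_j=\sum_{\ell=0}^{k-i}(-1)^\ell\binom{j}{\ell}\binom{k-j}{i-j+\ell}^2$. Let $\alpha=\gcd\{\lambda_0-\lambda_j : 0\le j\le k\}$. If $\binom{k}{i}$ is odd, then $\mathrm{ord}_2(\alpha)\le 1$.
   Context: $J(2k,k,i)$ is the graph on the $k$-subsets of $\{1,\dots,2k\}$ with $P\sim Q$ iff $|P\cap Q|=i$; its eigenvalues are the integers $\lambda_j$ given in the claim (with $\lambda_0=\binom{k}{i}^2$ the largest). For an integer $x$, $\mathrm{ord}_2(x)$ is the exponent of $2$ in $x$, with $\mathrm{ord}_2(0)=+\infty$. Binomial coefficients $\binom{a}{b}$ are $0$ when $b<0$ or $b>a\ge 0$. -}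

module Defs where

open import Data.Nat as ℕ using (ℕ; zero; suc; _∸_)
open import Data.Nat.Combinatorics using (_C_)
open import Data.Nat.GCD using (gcd)
open import Data.Integer as ℤ using (ℤ; +_; -[1+_]; ∣_∣)
open import Data.List using (List; map; foldr; upTo)

-- binomial coefficient with integer lower index: 0 when b < 0 (and 0 when b > a, via _C_)
binomℤ : ℕ → ℤ → ℕ
binomℤ a (+ b)      = a C b
binomℤ a -[1+ _ ]   = 0

sign : ℕ → ℤ
sign zero          = + 1
sign (suc ℓ)       = ℤ.- sign ℓ

Σ≤ : ℕ → (ℕ → ℤ) → ℤ
Σ≤ zero    f = f 0
Σ≤ (suc n) f = Σ≤ n f ℤ.+ f (suc n)

eig : ℕ → ℕ → ℕ → ℤ
eig k i j = Σ≤ (k ∸ i) λ ℓ →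
  sign ℓ ℤ.* (+ (j C ℓ)) ℤ.* (+ (binomℤ (k ∸ j) ((+ i ℤ.- + j) ℤ.+ + ℓ) ℕ.^ 2))

α : ℕ → ℕ → ℕ
α k i = foldr gcd 0 (map (λ j → ∣ eig k i 0 ℤ.- eig k i j ∣) (upTo (suc k)))

-- ord₂(x) ≤ 1  (with ord₂(0) = +∞), i.e. 2^2 does not divide x
ord₂≤1 : ℕ → Set
ord₂≤1 x = ¬ ((2 ℕ.^ 2) ∣ x)
  where open import Relation.Nullary using (¬_)
        open import Data.Nat.Divisibility using (_∣_)

module Submission where

-- Write c = C(k,i), which is odd, and suppose 4 divides α, i.e. λ_j ≡ λ_0 = c² ≡ 1 (mod 4) for all j.
-- We exhibit a j with λ_0 − λ_j ≡ 2 (mod 4). If C(k−1,i) is odd, j = 1 works, since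
-- λ_0 − λ_1 = c² − C(k−1,i−1)² + C(k−1,i)² = 2·C(k−1,i)·c. Otherwise Lucas' theorem forces
-- k ≡ i (mod 2), so λ_k = c and λ_0 − λ_k = c(c − 1) ≡ 2 when c ≡ 3. When c ≡ 1, descending through
-- the binary digits of k and i yields M = k − 2^(e+1) with λ_M ≡ C(M,i) + C(M,i−2^(e+1)) ≡ 3 (mod 4):
-- since C(2^(e+1),u) is even for 0 < u < 2^(e+1), all but two summands of λ_M vanish modulo 4.

open import Defs
open import Data.Nat using (ℕ; _≤_; _<_; _%_)
open import Data.Nat.Combinatorics using (_C_)
open import Relation.Binary.PropositionalEquality using (_≡_)

open import Data.Nat as ℕ using (zero; suc; _∸_; _^_; z≤n; s≤s; NonZero)
import Data.Nat.Properties as ℕ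
open import Data.Nat.Combinatorics using (nCk+nC[k+1]≡[n+1]C[k+1]; nCk≡nC[n∸k]; k>n⇒nCk≡0; nCn≡1)
open import Data.Nat.DivMod using (_/_; m≡m%n+[m/n]*n; m%n<n)
open import Data.Nat.Divisibility using (_∣_; ∣-trans)
open import Data.Nat.GCD using (gcd; gcd[m,n]∣m; gcd[m,n]∣n)
open import Data.Nat.Induction using (<-wellFounded)
open import Data.Integer using (ℤ; +_; -[1+_]; _+_; _-_; _*_; -_; ∣_∣)
import Data.Integer.Properties as ℤ
open import Data.Integer.Divisibility.Signed using (∣ᵤ⇒∣; divides)
open import Data.Integer.Tactic.RingSolver using (solve-∀)
open import Data.List using (_∷_; foldr)
open import Data.List.Relation.Unary.Any using (here; there)
open import Data.List.Membership.Propositional using (_∈_)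
open import Data.List.Membership.Propositional.Properties using (∈-map⁺; ∈-upTo⁺)
open import Data.Product using (Σ; _×_; _,_)
open import Data.Sum using (_⊎_; inj₁; inj₂)
open import Data.Empty using (⊥-elim)
open import Function using (_∘_)
open import Induction.WellFounded using (Acc; acc)
open import Level using (0ℓ)
open import Relation.Nullary using (¬_; yes; no)
open import Relation.Binary.Bundles using (Setoid)
open import Relation.Binary.Structures using (IsEquivalence)
open import Relation.Binary.Definitions using (tri<; tri≈; tri>)
open import Relation.Binary.PropositionalEquality using (_≢_; refl; sym; trans; cong; cong₂; subst; subst₂; module ≡-Reasoning)

-- Congruences of integers

infix 4 _≡_mod_
record _≡_mod_ (x y : ℤ) (m : ℕ) : Set where
  constructor quot
  field
    quotient : ℤ
    equation : x ≡ y + quotient * + m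

module _ {m : ℕ} where

  ≡⇒≡mod : ∀ {x y} → x ≡ y → x ≡ y mod m
  ≡⇒≡mod {x} refl = quot (+ 0) (witness x (+ m))
    where witness : ∀ x m → x ≡ x + + 0 * m
          witness = solve-∀

  ≡mod-refl : ∀ {x} → x ≡ x mod m
  ≡mod-refl = ≡⇒≡mod refl

  ≡mod-sym : ∀ {x y} → x ≡ y mod m → y ≡ x mod m
  ≡mod-sym {y = y} (quot q refl) = quot (- q) (witness y q (+ m))
    where witness : ∀ y q m → y ≡ (y + q * m) + (- q) * m
          witness = solve-∀

  ≡mod-trans : ∀ {x y z} → x ≡ y mod m → y ≡ z mod m → x ≡ z mod m
  ≡mod-trans {z = z} (quot q refl) (quot p refl) = quot (p + q) (witness z p q (+ m))
    where witness : ∀ z p q m → (z + p * m) + q * m ≡ z + (p + q) * m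
          witness = solve-∀

  ≡mod-isEquivalence : IsEquivalence (λ x y → x ≡ y mod m)
  ≡mod-isEquivalence = record { refl = ≡mod-refl ; sym = ≡mod-sym ; trans = ≡mod-trans }

  +-cong-mod : ∀ {x x′ y y′} → x ≡ x′ mod m → y ≡ y′ mod m → x + y ≡ x′ + y′ mod m
  +-cong-mod {x′ = x′} {y′ = y′} (quot p refl) (quot q refl) = quot (p + q) (witness x′ y′ p q (+ m))
    where witness : ∀ x y p q m → (x + p * m) + (y + q * m) ≡ (x + y) + (p + q) * m
          witness = solve-∀

  +-congˡ-mod : ∀ x {y y′} → y ≡ y′ mod m → x + y ≡ x + y′ mod m
  +-congˡ-mod x = +-cong-mod (≡mod-refl {x})

  -‿cong-mod : ∀ {x x′} → x ≡ x′ mod m → - x ≡ - x′ mod m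
  -‿cong-mod {x′ = x′} (quot p refl) = quot (- p) (witness x′ p (+ m))
    where witness : ∀ x p m → - (x + p * m) ≡ - x + (- p) * m
          witness = solve-∀

  -cong-mod : ∀ {x x′ y y′} → x ≡ x′ mod m → y ≡ y′ mod m → x - y ≡ x′ - y′ mod m
  -cong-mod p q = +-cong-mod p (-‿cong-mod q)

  *-cong-mod : ∀ {x x′ y y′} → x ≡ x′ mod m → y ≡ y′ mod m → x * y ≡ x′ * y′ mod m
  *-cong-mod {x′ = x′} {y′ = y′} (quot p refl) (quot q refl) =
    quot (p * y′ + q * x′ + p * q * + m) (witness x′ y′ p q (+ m))
    where witness : ∀ x y p q m → (x + p * m) * (y + q * m) ≡ x * y + (p * y + q * x + p * q * m) * m
          witness = solve-∀

  *-scale-mod : ∀ n {x y} → x ≡ y mod m → + n * x ≡ + n * y mod (n ℕ.* m)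
  *-scale-mod n {y = y} (quot q refl) = quot q (trans (witness (+ n) y q (+ m)) (cong (λ z → + n * y + q * z) (sym (ℤ.pos-* n m))))
    where witness : ∀ n y q m → n * (y + q * m) ≡ n * y + q * (n * m)
          witness = solve-∀

  mod-weaken : ∀ n {x y} → x ≡ y mod (m ℕ.* n) → x ≡ y mod m
  mod-weaken n {y = y} (quot q refl) = quot (q * + n) (trans (cong (λ z → y + q * z) (ℤ.pos-* m n)) (witness y q (+ m) (+ n)))
    where witness : ∀ y q m n → y + q * (m * n) ≡ y + q * n * m
          witness = solve-∀

mod-4⇒mod-2 : ∀ {x y} → x ≡ y mod 4 → x ≡ y mod 2
mod-4⇒mod-2 = mod-weaken 2

≡mod-setoid : ℕ → Setoid 0ℓ 0ℓ
≡mod-setoid m = record { isEquivalence = ≡mod-isEquivalence {m} }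

module ≡mod-Reasoning (m : ℕ) where
  open import Relation.Binary.Reasoning.Setoid (≡mod-setoid m) public

≡%-mod : ∀ x m .{{_ : NonZero m}} → + x ≡ + (x % m) mod m
≡%-mod x m = quot (+ (x / m)) (trans (cong +_ (m≡m%n+[m/n]*n x m)) (trans (ℤ.pos-+ (x % m) _) (cong (_+_ (+ (x % m))) (ℤ.pos-* (x / m) m))))

¬1≡0-mod-2 : ¬ (+ 1 ≡ + 0 mod 2)
¬1≡0-mod-2 (quot (+ zero) ())
¬1≡0-mod-2 (quot (+ suc _) ())
¬1≡0-mod-2 (quot -[1+ _ ] ())

¬2≡0-mod-4 : ¬ (+ 2 ≡ + 0 mod 4)
¬2≡0-mod-4 (quot (+ zero) ())
¬2≡0-mod-4 (quot (+ suc _) ())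
¬2≡0-mod-4 (quot -[1+ _ ] ())

even-or-odd : ∀ x → + x ≡ + 0 mod 2 ⊎ + x ≡ + 1 mod 2
even-or-odd x with x % 2 | m%n<n x 2 | ≡%-mod x 2
... | 0 | _ | x≡0 = inj₁ x≡0
... | 1 | _ | x≡1 = inj₂ x≡1
... | suc (suc _) | s≤s (s≤s ()) | _

odd⇒≡1⊎≡3-mod-4 : ∀ x → + x ≡ + 1 mod 2 → + x ≡ + 1 mod 4 ⊎ + x ≡ + 3 mod 4
odd⇒≡1⊎≡3-mod-4 x x-odd with x % 4 | m%n<n x 4 | ≡%-mod x 4
... | 0 | _ | x≡0 = ⊥-elim (¬1≡0-mod-2 (≡mod-trans (≡mod-sym x-odd) (mod-4⇒mod-2 x≡0)))
... | 1 | _ | x≡1 = inj₁ x≡1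
... | 2 | _ | x≡2 = ⊥-elim (¬1≡0-mod-2 (≡mod-trans (≡mod-sym x-odd) (≡mod-trans (mod-4⇒mod-2 x≡2) (quot (+ 1) refl))))
... | 3 | _ | x≡3 = inj₂ x≡3
... | suc (suc (suc (suc _))) | s≤s (s≤s (s≤s (s≤s ()))) | _

-- Binomial coefficients modulo 2 and 4

binom : ℕ → ℕ → ℤ
binom n r = + (n C r)

double : ℕ → ℕ
double zero    = zero
double (suc n) = suc (suc (double n))

data Parity : ℕ → Set where
  even : ∀ a → Parity (double a)
  odd  : ∀ a → Parity (suc (double a))

parity : ∀ n → Parity n
parity zero = even zero
parity (suc n) with parity n
... | even a = odd a
... | odd a  = even (suc a)

double≡+ : ∀ a → double a ≡ a ℕ.+ a
double≡+ zero    = refl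
double≡+ (suc a) = cong suc (trans (cong suc (double≡+ a)) (sym (ℕ.+-suc a a)))

double-+ : ∀ a b → double (a ℕ.+ b) ≡ double a ℕ.+ double b
double-+ zero    b = refl
double-+ (suc a) b = cong (suc ∘ suc) (double-+ a b)

double-∸ : ∀ a b → double a ∸ double b ≡ double (a ∸ b)
double-∸ a       zero    = refl
double-∸ zero    (suc b) = refl
double-∸ (suc a) (suc b) = double-∸ a b

2^[1+e]≡2^e+2^e : ∀ e → 2 ^ suc e ≡ 2 ^ e ℕ.+ 2 ^ e
2^[1+e]≡2^e+2^e e = cong (2 ^ e ℕ.+_) (ℕ.+-identityʳ (2 ^ e))

2^[1+e]≡double[2^e] : ∀ e → 2 ^ suc e ≡ double (2 ^ e)
2^[1+e]≡double[2^e] e = trans (2^[1+e]≡2^e+2^e e) (sym (double≡+ (2 ^ e)))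

binom-pascal : ∀ n r → binom (suc n) (suc r) ≡ binom n r + binom n (suc r)
binom-pascal n r = trans (cong +_ (sym (nCk+nC[k+1]≡[n+1]C[k+1] n r))) (ℤ.pos-+ (n C r) (n C suc r))

binom-pascal² : ∀ n r → binom (2 ℕ.+ n) (2 ℕ.+ r) ≡ binom n r + (binom n (suc r) + binom n (suc r)) + binom n (2 ℕ.+ r)
binom-pascal² n r = begin
    binom (2 ℕ.+ n) (2 ℕ.+ r)
  ≡⟨ binom-pascal (suc n) (suc r) ⟩
    binom (suc n) (suc r) + binom (suc n) (2 ℕ.+ r)
  ≡⟨ cong₂ _+_ (binom-pascal n r) (binom-pascal n (suc r)) ⟩
    (binom n r + binom n (suc r)) + (binom n (suc r) + binom n (2 ℕ.+ r))
  ≡⟨ regroup (binom n r) (binom n (suc r)) (binom n (2 ℕ.+ r)) ⟩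
    binom n r + (binom n (suc r) + binom n (suc r)) + binom n (2 ℕ.+ r) ∎
  where
    open ≡-Reasoning
    regroup : ∀ x y z → (x + y) + (y + z) ≡ x + (y + y) + z
    regroup = solve-∀

[2+n]C1≡2+nC1 : ∀ n → binom (2 ℕ.+ n) 1 ≡ + 2 + binom n 1
[2+n]C1≡2+nC1 n = begin
    binom (2 ℕ.+ n) 1                ≡⟨ binom-pascal (suc n) 0 ⟩
    + 1 + binom (suc n) 1            ≡⟨ cong (_+_ (+ 1)) (binom-pascal n 0) ⟩
    + 1 + (+ 1 + binom n 1)          ≡⟨ sym (ℤ.+-assoc (+ 1) (+ 1) (binom n 1)) ⟩
    + 2 + binom n 1                  ∎
  where open ≡-Reasoning

x+x≡0-mod-2 : ∀ x → x + x ≡ + 0 mod 2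
x+x≡0-mod-2 x = quot x (regroup x)
  where regroup : ∀ x → x + x ≡ + 0 + x * + 2
        regroup = solve-∀

x+x≡2x : ∀ x → x + x ≡ + 2 * x
x+x≡2x = solve-∀

even⇒x+x≡0-mod-4 : ∀ {x} → x ≡ + 0 mod 2 → x + x ≡ + 0 mod 4
even⇒x+x≡0-mod-4 {x} x≡0 = ≡mod-trans (≡⇒≡mod (x+x≡2x x)) (*-scale-mod 2 x≡0)

[2a]C[1+2b]≡0-mod-2 : ∀ a b → binom (double a) (suc (double b)) ≡ + 0 mod 2
[2a]C[1+2b]≡0-mod-2 zero    b = ≡mod-refl
[2a]C[1+2b]≡0-mod-2 (suc a) zero = begin
    binom (2 ℕ.+ double a) 1   ≡⟨ [2+n]C1≡2+nC1 (double a) ⟩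
    + 2 + binom (double a) 1   ≈⟨ +-cong-mod {x = + 2} {x′ = + 0} (quot (+ 1) refl) ([2a]C[1+2b]≡0-mod-2 a zero) ⟩
    + 0                        ∎
  where open ≡mod-Reasoning 2
[2a]C[1+2b]≡0-mod-2 (suc a) (suc b) = begin
    binom (2 ℕ.+ double a) (2 ℕ.+ suc (double b))
  ≡⟨ binom-pascal² (double a) (suc (double b)) ⟩
    binom (double a) (suc (double b)) + (y + y) + binom (double a) (suc (double (suc b)))
  ≈⟨ +-cong-mod (+-cong-mod ([2a]C[1+2b]≡0-mod-2 a b) (x+x≡0-mod-2 y)) ([2a]C[1+2b]≡0-mod-2 a (suc b)) ⟩
    + 0 ∎
  where
    open ≡mod-Reasoning 2
    y = binom (double a) (2 ℕ.+ double b)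

[2a]C[2b]≡aCb-mod-4 : ∀ a b → binom (double a) (double b) ≡ binom a b mod 4
[2a]C[2b]≡aCb-mod-4 zero    zero    = ≡mod-refl
[2a]C[2b]≡aCb-mod-4 zero    (suc b) = ≡mod-refl
[2a]C[2b]≡aCb-mod-4 (suc a) zero    = ≡mod-refl
[2a]C[2b]≡aCb-mod-4 (suc a) (suc b) = begin
    binom (2 ℕ.+ double a) (2 ℕ.+ double b)
  ≡⟨ binom-pascal² (double a) (double b) ⟩
    binom (double a) (double b) + (y + y) + binom (double a) (double (suc b))
  ≈⟨ +-cong-mod (+-cong-mod ([2a]C[2b]≡aCb-mod-4 a b) (even⇒x+x≡0-mod-4 ([2a]C[1+2b]≡0-mod-2 a b)))
                ([2a]C[2b]≡aCb-mod-4 a (suc b)) ⟩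
    binom a b + + 0 + binom a (suc b)
  ≡⟨ cong (_+ binom a (suc b)) (ℤ.+-identityʳ (binom a b)) ⟩
    binom a b + binom a (suc b)
  ≡⟨ binom-pascal a b ⟨
    binom (suc a) (suc b) ∎
  where
    open ≡mod-Reasoning 4
    y = binom (double a) (suc (double b))

[2+2a]C[1+2b]≡2[1+a]aCb-mod-4 : ∀ a b → binom (double (suc a)) (suc (double b)) ≡ + 2 * + (suc a) * binom a b mod 4
[2+2a]C[1+2b]≡2[1+a]aCb-mod-4 zero    zero    = ≡mod-refl
[2+2a]C[1+2b]≡2[1+a]aCb-mod-4 zero    (suc b) = ≡mod-refl
[2+2a]C[1+2b]≡2[1+a]aCb-mod-4 (suc a) zero    = begin
    binom (2 ℕ.+ double (suc a)) 1
  ≡⟨ [2+n]C1≡2+nC1 (double (suc a)) ⟩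
    + 2 + binom (double (suc a)) 1
  ≈⟨ +-congˡ-mod (+ 2) ([2+2a]C[1+2b]≡2[1+a]aCb-mod-4 a zero) ⟩
    + 2 + + 2 * (+ 1 + + a) * + 1
  ≡⟨ regroup (+ a) ⟩
    + 2 * (+ 1 + (+ 1 + + a)) * + 1 ∎
  where
    open ≡mod-Reasoning 4
    regroup : ∀ x → + 2 + + 2 * (+ 1 + x) * + 1 ≡ + 2 * (+ 1 + (+ 1 + x)) * + 1
    regroup = solve-∀
[2+2a]C[1+2b]≡2[1+a]aCb-mod-4 (suc a) (suc b) = begin
    binom (2 ℕ.+ double (suc a)) (2 ℕ.+ suc (double b))
  ≡⟨ binom-pascal² (double (suc a)) (suc (double b)) ⟩
    binom (double (suc a)) (suc (double b)) + (y + y) + binom (double (suc a)) (suc (double (suc b)))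
  ≈⟨ +-cong-mod (+-cong-mod ([2+2a]C[1+2b]≡2[1+a]aCb-mod-4 a b) y+y≡2[1+a]C[1+b])
                ([2+2a]C[1+2b]≡2[1+a]aCb-mod-4 a (suc b)) ⟩
    + 2 * A * binom a b + + 2 * binom (suc a) (suc b) + + 2 * A * binom a (suc b)
  ≡⟨ cong (λ w → + 2 * A * binom a b + + 2 * w + + 2 * A * binom a (suc b)) (binom-pascal a b) ⟩
    + 2 * A * binom a b + + 2 * (binom a b + binom a (suc b)) + + 2 * A * binom a (suc b)
  ≡⟨ regroup (+ a) (binom a b) (binom a (suc b)) ⟩
    + 2 * (+ 1 + A) * (binom a b + binom a (suc b))
  ≡⟨ cong (+ 2 * (+ 1 + A) *_) (binom-pascal a b) ⟨
    + 2 * (+ 1 + A) * binom (suc a) (suc b) ∎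
  where
    open ≡mod-Reasoning 4
    A = + 1 + + a
    y = binom (double (suc a)) (double (suc b))
    y+y≡2[1+a]C[1+b] : y + y ≡ + 2 * binom (suc a) (suc b) mod 4
    y+y≡2[1+a]C[1+b] = ≡mod-trans (≡⇒≡mod (x+x≡2x y))
                         (*-scale-mod 2 (mod-4⇒mod-2 ([2a]C[2b]≡aCb-mod-4 (suc a) (suc b))))
    regroup : ∀ x u v → + 2 * (+ 1 + x) * u + + 2 * (u + v) + + 2 * (+ 1 + x) * v
                    ≡ + 2 * (+ 1 + (+ 1 + x)) * (u + v)
    regroup = solve-∀

[1+2a]C[1+2b]≡aCb+2a[a-1]Cb-mod-4 : ∀ a b → binom (suc (double a)) (suc (double b)) ≡ binom a b + + 2 * + a * binom (a ∸ 1) b mod 4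
[1+2a]C[1+2b]≡aCb+2a[a-1]Cb-mod-4 a b = begin
    binom (suc (double a)) (suc (double b))
  ≡⟨ binom-pascal (double a) (double b) ⟩
    binom (double a) (double b) + binom (double a) (suc (double b))
  ≈⟨ +-cong-mod ([2a]C[2b]≡aCb-mod-4 a b) (odd-part a) ⟩
    binom a b + + 2 * + a * binom (a ∸ 1) b ∎
  where
    open ≡mod-Reasoning 4
    odd-part : ∀ a → binom (double a) (suc (double b)) ≡ + 2 * + a * binom (a ∸ 1) b mod 4
    odd-part zero     = ≡mod-refl
    odd-part (suc a′) = [2+2a]C[1+2b]≡2[1+a]aCb-mod-4 a′ b

[1+2a]C[2b]≡aCb-mod-2 : ∀ a b → binom (suc (double a)) (double b) ≡ binom a b mod 2
[1+2a]C[2b]≡aCb-mod-2 a zero    = ≡mod-refl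
[1+2a]C[2b]≡aCb-mod-2 a (suc b) = begin
    binom (suc (double a)) (double (suc b))
  ≡⟨ binom-pascal (double a) (suc (double b)) ⟩
    binom (double a) (suc (double b)) + binom (double a) (double (suc b))
  ≈⟨ +-cong-mod ([2a]C[1+2b]≡0-mod-2 a b) (mod-4⇒mod-2 ([2a]C[2b]≡aCb-mod-4 a (suc b))) ⟩
    + 0 + binom a (suc b)
  ≡⟨ ℤ.+-identityˡ _ ⟩
    binom a (suc b) ∎
  where open ≡mod-Reasoning 2

-- f ⟪ r ∸ m ⟫ is f (r - m) extended by 0 (not f 0) for r < m, as for a binomial coefficient with negative lower index.
infixl 10 _⟪_∸_⟫
_⟪_∸_⟫ : (ℕ → ℤ) → ℕ → ℕ → ℤ
f ⟪ r     ∸ zero  ⟫ = f r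
f ⟪ zero  ∸ suc m ⟫ = + 0
f ⟪ suc r ∸ suc m ⟫ = f ⟪ r ∸ m ⟫

⟪∸⟫-< : ∀ f {r m} → r < m → f ⟪ r ∸ m ⟫ ≡ + 0
⟪∸⟫-< f {zero}  {suc m} _         = refl
⟪∸⟫-< f {suc r} {suc m} (s≤s r<m) = ⟪∸⟫-< f r<m

⟪+∸⟫ : ∀ f m r → f ⟪ m ℕ.+ r ∸ m ⟫ ≡ f r
⟪+∸⟫ f zero    r = refl
⟪+∸⟫ f (suc m) r = ⟪+∸⟫ f m r

⟪∸⟫-∘ : ∀ f m r m′ → (λ x → f ⟪ x ∸ m ⟫) ⟪ r ∸ m′ ⟫ ≡ f ⟪ r ∸ m′ ℕ.+ m ⟫
⟪∸⟫-∘ f m r       zero     = refl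
⟪∸⟫-∘ f m zero    (suc m′) = refl
⟪∸⟫-∘ f m (suc r) (suc m′) = ⟪∸⟫-∘ f m r m′

⟪∸⟫-+ : ∀ f g r m → (λ x → f x + g x) ⟪ r ∸ m ⟫ ≡ f ⟪ r ∸ m ⟫ + g ⟪ r ∸ m ⟫
⟪∸⟫-+ f g r       zero    = refl
⟪∸⟫-+ f g zero    (suc m) = refl
⟪∸⟫-+ f g (suc r) (suc m) = ⟪∸⟫-+ f g r m

⟪∸⟫-* : ∀ c f r m → (λ x → c * f x) ⟪ r ∸ m ⟫ ≡ c * f ⟪ r ∸ m ⟫
⟪∸⟫-* c f r       zero    = refl
⟪∸⟫-* c f zero    (suc m) = sym (ℤ.*-zeroʳ c)
⟪∸⟫-* c f (suc r) (suc m) = ⟪∸⟫-* c f r m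

⟪∸⟫-cong-mod : ∀ {q f g} → (∀ x → f x ≡ g x mod q) → ∀ r m → f ⟪ r ∸ m ⟫ ≡ g ⟪ r ∸ m ⟫ mod q
⟪∸⟫-cong-mod f≡g r       zero    = f≡g r
⟪∸⟫-cong-mod f≡g zero    (suc m) = ≡mod-refl
⟪∸⟫-cong-mod f≡g (suc r) (suc m) = ⟪∸⟫-cong-mod f≡g r m

⟪double∸double⟫ : ∀ f r m → f ⟪ double r ∸ double m ⟫ ≡ (f ∘ double) ⟪ r ∸ m ⟫
⟪double∸double⟫ f r       zero    = refl
⟪double∸double⟫ f zero    (suc m) = refl
⟪double∸double⟫ f (suc r) (suc m) = ⟪double∸double⟫ f r m

⟪1+double∸double⟫ : ∀ f r m → f ⟪ suc (double r) ∸ double m ⟫ ≡ (f ∘ suc ∘ double) ⟪ r ∸ m ⟫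
⟪1+double∸double⟫ f r       zero    = refl
⟪1+double∸double⟫ f zero    (suc m) = refl
⟪1+double∸double⟫ f (suc r) (suc m) = ⟪1+double∸double⟫ f r m

binom-suc : ∀ n r → binom (suc n) r ≡ binom n r + binom n ⟪ r ∸ 1 ⟫
binom-suc n zero    = refl
binom-suc n (suc r) = trans (binom-pascal n r) (ℤ.+-comm (binom n r) (binom n (suc r)))

[n+2^e]Cr≡nCr+nC[r∸2^e]-mod-2 : ∀ e n r → binom (n ℕ.+ 2 ^ e) r ≡ binom n r + binom n ⟪ r ∸ 2 ^ e ⟫ mod 2
[n+2^e]Cr≡nCr+nC[r∸2^e]-mod-2 zero n r = ≡⇒≡mod (trans (cong (λ z → binom z r) (ℕ.+-comm n 1)) (binom-suc n r))
[n+2^e]Cr≡nCr+nC[r∸2^e]-mod-2 (suc e) n r = begin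
    binom (n ℕ.+ 2 ^ suc e) r
  ≡⟨ cong (λ z → binom z r) (trans (cong (n ℕ.+_) (2^[1+e]≡2^e+2^e e)) (sym (ℕ.+-assoc n m m))) ⟩
    binom (n ℕ.+ m ℕ.+ m) r
  ≈⟨ IH (n ℕ.+ m) r ⟩
    binom (n ℕ.+ m) r + binom (n ℕ.+ m) ⟪ r ∸ m ⟫
  ≈⟨ +-cong-mod (IH n r) (⟪∸⟫-cong-mod (IH n) r m) ⟩
    (binom n r + binom n ⟪ r ∸ m ⟫) + (λ x → binom n x + binom n ⟪ x ∸ m ⟫) ⟪ r ∸ m ⟫
  ≡⟨ cong (_+_ (binom n r + binom n ⟪ r ∸ m ⟫))
          (trans (⟪∸⟫-+ (binom n) (λ x → binom n ⟪ x ∸ m ⟫) r m) (cong (_+_ (binom n ⟪ r ∸ m ⟫)) (⟪∸⟫-∘ (binom n) m r m))) ⟩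
    (binom n r + binom n ⟪ r ∸ m ⟫) + (binom n ⟪ r ∸ m ⟫ + binom n ⟪ r ∸ m ℕ.+ m ⟫)
  ≡⟨ regroup (binom n r) (binom n ⟪ r ∸ m ⟫) (binom n ⟪ r ∸ m ℕ.+ m ⟫) ⟩
    binom n r + binom n ⟪ r ∸ m ℕ.+ m ⟫ + (binom n ⟪ r ∸ m ⟫ + binom n ⟪ r ∸ m ⟫)
  ≈⟨ +-congˡ-mod (binom n r + binom n ⟪ r ∸ m ℕ.+ m ⟫) (x+x≡0-mod-2 (binom n ⟪ r ∸ m ⟫)) ⟩
    binom n r + binom n ⟪ r ∸ m ℕ.+ m ⟫ + + 0
  ≡⟨ ℤ.+-identityʳ _ ⟩
    binom n r + binom n ⟪ r ∸ m ℕ.+ m ⟫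
  ≡⟨ cong (λ z → binom n r + binom n ⟪ r ∸ z ⟫) (2^[1+e]≡2^e+2^e e) ⟨
    binom n r + binom n ⟪ r ∸ 2 ^ suc e ⟫ ∎
  where
    open ≡mod-Reasoning 2
    m = 2 ^ e
    IH = [n+2^e]Cr≡nCr+nC[r∸2^e]-mod-2 e
    regroup : ∀ x y z → (x + y) + (y + z) ≡ x + z + (y + y)
    regroup = solve-∀

2^eCr≡0-mod-2 : ∀ e {r} → 0 < r → r < 2 ^ e → binom (2 ^ e) r ≡ + 0 mod 2
2^eCr≡0-mod-2 e {suc r} _ r<2^e = ≡mod-trans ([n+2^e]Cr≡nCr+nC[r∸2^e]-mod-2 e 0 (suc r))
                                   (≡⇒≡mod (trans (ℤ.+-identityˡ _) (⟪∸⟫-< (binom 0) r<2^e)))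

-- Descent along binary digits

data SameParity : ℕ → ℕ → Set where
  both-even : ∀ a b → SameParity (double a) (double b)
  both-odd  : ∀ a b → SameParity (suc (double a)) (suc (double b))

same-parity : ∀ n r → binom n r ≡ + 1 mod 2 → binom (n ∸ 1) r ≡ + 0 mod 2 → SameParity n r
same-parity n r n-odd n-1-even with parity n | parity r
... | even a | even b = both-even a b
... | odd a  | odd b  = both-odd a b
... | even a | odd b  = ⊥-elim (¬1≡0-mod-2 (≡mod-trans (≡mod-sym n-odd) ([2a]C[1+2b]≡0-mod-2 a b)))
... | odd a  | even b = ⊥-elim (¬1≡0-mod-2 (≡mod-trans (≡mod-sym n-odd) n≡n-1))
  where
    n≡n-1 : binom (suc (double a)) (double b) ≡ + 0 mod 2
    n≡n-1 = ≡mod-trans ([1+2a]C[2b]≡aCb-mod-2 a b)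
              (≡mod-trans (≡mod-sym (mod-4⇒mod-2 ([2a]C[2b]≡aCb-mod-4 a b))) n-1-even)

-- By eig-M, the sum in ≡3 is the eigenvalue at M = n − 2^(e+1) modulo 4.
record Split≡3 (n r : ℕ) : Set where
  constructor split
  field
    e M   : ℕ
    n≡M+m : n ≡ M ℕ.+ 2 ^ suc e
    ≡3    : binom M r + binom M ⟪ r ∸ 2 ^ suc e ⟫ ≡ + 3 mod 4

regroup-2A : ∀ v w s t A → (v + + 2 * A * w) + (s + + 2 * A * t) ≡ (v + s) + + 2 * (A * (w + t))
regroup-2A = solve-∀

Split≡3-double : ∀ {a b} → Split≡3 a b → Split≡3 (double a) (double b)
Split≡3-double {a} {b} (split e M a≡M+m M≡3) = split (suc e) (double M) 2a≡2M+2m (begin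
    binom (double M) (double b) + binom (double M) ⟪ double b ∸ 2 ^ suc (suc e) ⟫
  ≡⟨ cong (λ z → binom (double M) (double b) + binom (double M) ⟪ double b ∸ z ⟫) (2^[1+e]≡double[2^e] (suc e)) ⟩
    binom (double M) (double b) + binom (double M) ⟪ double b ∸ double m ⟫
  ≡⟨ cong (_+_ (binom (double M) (double b))) (⟪double∸double⟫ (binom (double M)) b m) ⟩
    binom (double M) (double b) + (binom (double M) ∘ double) ⟪ b ∸ m ⟫
  ≈⟨ +-cong-mod ([2a]C[2b]≡aCb-mod-4 M b) (⟪∸⟫-cong-mod ([2a]C[2b]≡aCb-mod-4 M) b m) ⟩
    binom M b + binom M ⟪ b ∸ m ⟫
  ≈⟨ M≡3 ⟩
    + 3 ∎)
  where
    open ≡mod-Reasoning 4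
    m = 2 ^ suc e
    2a≡2M+2m : double a ≡ double M ℕ.+ 2 ^ suc (suc e)
    2a≡2M+2m = trans (cong double a≡M+m) (trans (double-+ M m) (cong (double M ℕ.+_) (sym (2^[1+e]≡double[2^e] (suc e)))))

[1+2a]C[1+2b∸2m]≡aC[b∸m]+2a[a-1]C[b∸m]-mod-4 : ∀ a b m →
  binom (suc (double a)) ⟪ suc (double b) ∸ double m ⟫ ≡ binom a ⟪ b ∸ m ⟫ + + 2 * + a * binom (a ∸ 1) ⟪ b ∸ m ⟫ mod 4
[1+2a]C[1+2b∸2m]≡aC[b∸m]+2a[a-1]C[b∸m]-mod-4 a b m = begin
    binom (suc (double a)) ⟪ suc (double b) ∸ double m ⟫
  ≡⟨ ⟪1+double∸double⟫ (binom (suc (double a))) b m ⟩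
    (binom (suc (double a)) ∘ suc ∘ double) ⟪ b ∸ m ⟫
  ≈⟨ ⟪∸⟫-cong-mod ([1+2a]C[1+2b]≡aCb+2a[a-1]Cb-mod-4 a) b m ⟩
    (λ x → binom a x + + 2 * + a * binom (a ∸ 1) x) ⟪ b ∸ m ⟫
  ≡⟨ ⟪∸⟫-+ (binom a) (λ x → + 2 * + a * binom (a ∸ 1) x) b m ⟩
    binom a ⟪ b ∸ m ⟫ + (λ x → + 2 * + a * binom (a ∸ 1) x) ⟪ b ∸ m ⟫
  ≡⟨ cong (_+_ (binom a ⟪ b ∸ m ⟫)) (⟪∸⟫-* (+ 2 * + a) (binom (a ∸ 1)) b m) ⟩
    binom a ⟪ b ∸ m ⟫ + + 2 * + a * binom (a ∸ 1) ⟪ b ∸ m ⟫ ∎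
  where open ≡mod-Reasoning 4

Split≡3-1+double : ∀ {a b} → binom (a ∸ 1) b ≡ + 0 mod 2 → Split≡3 a b → Split≡3 (suc (double a)) (suc (double b))
Split≡3-1+double {a} {b} a-1-even (split e M a≡M+m M≡3) = split (suc e) (suc (double M)) 2a+1≡2M+1+2m (begin
    binom (suc (double M)) (suc (double b)) + binom (suc (double M)) ⟪ suc (double b) ∸ 2 ^ suc (suc e) ⟫
  ≡⟨ cong (λ z → binom (suc (double M)) (suc (double b)) + binom (suc (double M)) ⟪ suc (double b) ∸ z ⟫) (2^[1+e]≡double[2^e] (suc e)) ⟩
    binom (suc (double M)) (suc (double b)) + binom (suc (double M)) ⟪ suc (double b) ∸ double m ⟫
  ≈⟨ +-cong-mod ([1+2a]C[1+2b]≡aCb+2a[a-1]Cb-mod-4 M b) ([1+2a]C[1+2b∸2m]≡aC[b∸m]+2a[a-1]C[b∸m]-mod-4 M b m) ⟩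
    (binom M b + + 2 * + M * binom (M ∸ 1) b) + (binom M ⟪ b ∸ m ⟫ + + 2 * + M * binom (M ∸ 1) ⟪ b ∸ m ⟫)
  ≡⟨ regroup-2A (binom M b) (binom (M ∸ 1) b) (binom M ⟪ b ∸ m ⟫) (binom (M ∸ 1) ⟪ b ∸ m ⟫) (+ M) ⟩
    (binom M b + binom M ⟪ b ∸ m ⟫) + + 2 * (+ M * (binom (M ∸ 1) b + binom (M ∸ 1) ⟪ b ∸ m ⟫))
  ≈⟨ +-cong-mod M≡3 (*-scale-mod 2 (M*[[M-1]Cb+[M-1]C[b∸m]]≡0-mod-2 M a≡M+m)) ⟩
    + 3 ∎)
  where
    open ≡mod-Reasoning 4
    m = 2 ^ suc e
    2a+1≡2M+1+2m : suc (double a) ≡ suc (double M) ℕ.+ 2 ^ suc (suc e)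
    2a+1≡2M+1+2m = cong suc (trans (cong double a≡M+m) (trans (double-+ M m) (cong (double M ℕ.+_) (sym (2^[1+e]≡double[2^e] (suc e))))))
    -- The bracket is binom (a ∸ 1) b modulo 2 by the freshman's dream.
    M*[[M-1]Cb+[M-1]C[b∸m]]≡0-mod-2 : ∀ M → a ≡ M ℕ.+ m → + M * (binom (M ∸ 1) b + binom (M ∸ 1) ⟪ b ∸ m ⟫) ≡ + 0 mod 2
    M*[[M-1]Cb+[M-1]C[b∸m]]≡0-mod-2 zero    _      = ≡mod-refl
    M*[[M-1]Cb+[M-1]C[b∸m]]≡0-mod-2 (suc M′) a≡M+m =
      ≡mod-trans (*-cong-mod (≡mod-refl {x = + suc M′})
                   (≡mod-trans (≡mod-sym ([n+2^e]Cr≡nCr+nC[r∸2^e]-mod-2 (suc e) M′ b))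
                               (subst (λ z → binom (z ∸ 1) b ≡ + 0 mod 2) a≡M+m a-1-even)))
                 (≡⇒≡mod (ℤ.*-zeroʳ (+ suc M′)))

Split≡3-base : ∀ a b → binom a b ≡ + 1 mod 2 → binom (suc (double (suc a))) (suc (double b)) ≡ + 1 mod 4 →
               Split≡3 (suc (double (suc a))) (suc (double b))
Split≡3-base a b v-odd n≡1 = split 0 (suc (double a)) (cong suc (ℕ.+-comm 2 (double a))) (begin
    binom (suc (double a)) (suc (double b)) + binom (suc (double a)) ⟪ suc (double b) ∸ double 1 ⟫
  ≈⟨ +-cong-mod ([1+2a]C[1+2b]≡aCb+2a[a-1]Cb-mod-4 a b) ([1+2a]C[1+2b∸2m]≡aC[b∸m]+2a[a-1]C[b∸m]-mod-4 a b 1) ⟩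
    (v + + 2 * A * binom (a ∸ 1) b) + (binom a ⟪ b ∸ 1 ⟫ + + 2 * A * binom (a ∸ 1) ⟪ b ∸ 1 ⟫)
  ≡⟨ regroup-2A v (binom (a ∸ 1) b) (binom a ⟪ b ∸ 1 ⟫) (binom (a ∸ 1) ⟪ b ∸ 1 ⟫) A ⟩
    (v + binom a ⟪ b ∸ 1 ⟫) + + 2 * (A * (binom (a ∸ 1) b + binom (a ∸ 1) ⟪ b ∸ 1 ⟫))
  ≡⟨ cong₂ (λ x y → x + + 2 * y) (sym (binom-suc a b)) (a*[a-1]C-suc a) ⟩
    u + + 2 * (A * v)
  ≡⟨ regroup′ u v A ⟩
    (u + + 2 * (+ 1 + A) * v) - + 2 * v
  ≈⟨ -cong-mod (≡mod-trans (≡mod-sym ([1+2a]C[1+2b]≡aCb+2a[a-1]Cb-mod-4 (suc a) b)) n≡1) (*-scale-mod 2 v-odd) ⟩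
    + 1 - + 2 * + 1
  ≈⟨ quot (- + 1) refl ⟩
    + 3 ∎)
  where
    open ≡mod-Reasoning 4
    u = binom (suc a) b
    v = binom a b
    A = + a
    a*[a-1]C-suc : ∀ a → + a * (binom (a ∸ 1) b + binom (a ∸ 1) ⟪ b ∸ 1 ⟫) ≡ + a * binom a b
    a*[a-1]C-suc zero     = refl
    a*[a-1]C-suc (suc a′) = cong (_*_ (+ suc a′)) (sym (binom-suc a′ b))
    regroup′ : ∀ u v A → u + + 2 * (A * v) ≡ (u + + 2 * (+ 1 + A) * v) - + 2 * v
    regroup′ = solve-∀

1+a<double[1+a] : ∀ a → suc a < double (suc a)
1+a<double[1+a] a = s≤s (s≤s (a≤2a a))
  where
    a≤2a : ∀ a → a ≤ double a
    a≤2a zero    = z≤n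
    a≤2a (suc a) = s≤s (ℕ.m≤n⇒m≤1+n (a≤2a a))

double-cancel-< : ∀ {b a} → double b < double a → b < a
double-cancel-< {zero}  {suc a} _                 = s≤s z≤n
double-cancel-< {suc b} {suc a} (s≤s (s≤s 2b<2a)) = s≤s (double-cancel-< 2b<2a)

split≡3 : ∀ n r → Acc _<_ n → r < n → binom n r ≡ + 1 mod 4 → binom (n ∸ 1) r ≡ + 0 mod 2 → Split≡3 n r
split≡3 n r (acc rec) r<n n≡1 n-1-even with same-parity n r (mod-4⇒mod-2 n≡1) n-1-even
... | both-even (suc a′) b = Split≡3-double (split≡3 a b (rec (1+a<double[1+a] a′)) (double-cancel-< r<n) a≡1 a-1-even)
  where
    a = suc a′
    a≡1 : binom a b ≡ + 1 mod 4
    a≡1 = ≡mod-trans (≡mod-sym ([2a]C[2b]≡aCb-mod-4 a b)) n≡1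
    a-1-even : binom a′ b ≡ + 0 mod 2
    a-1-even = ≡mod-trans (≡mod-sym ([1+2a]C[2b]≡aCb-mod-2 a′ b)) n-1-even
... | both-odd zero b = ⊥-elim (ℕ.n≮0 (ℕ.≤-pred r<n))
... | both-odd (suc a′) b with even-or-odd (a′ C b)
...   | inj₂ a-1-odd  = Split≡3-base a′ b a-1-odd n≡1
...   | inj₁ a-1-even = Split≡3-1+double a-1-even (split≡3 a b (rec (ℕ.m≤n⇒m≤1+n (1+a<double[1+a] a′))) (double-cancel-< (ℕ.≤-pred r<n)) a≡1 a-1-even)
  where
    a = suc a′
    a≡1 : binom a b ≡ + 1 mod 4
    a≡1 = begin
        binom a b                                     ≡⟨ ℤ.+-identityʳ (binom a b) ⟨
        binom a b + + 0                               ≈⟨ +-congˡ-mod (binom a b) (*-scale-mod 2 (≡mod-trans (*-cong-mod (≡mod-refl {x = + a}) a-1-even) (≡⇒≡mod (ℤ.*-zeroʳ (+ a))))) ⟨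
        binom a b + + 2 * (+ a * binom a′ b)          ≡⟨ cong (_+_ (binom a b)) (ℤ.*-assoc (+ 2) (+ a) (binom a′ b)) ⟨
        binom a b + + 2 * + a * binom a′ b            ≈⟨ [1+2a]C[1+2b]≡aCb+2a[a-1]Cb-mod-4 a b ⟨
        binom (suc (double a)) (suc (double b))       ≈⟨ n≡1 ⟩
        + 1                                           ∎
      where open ≡mod-Reasoning 4

-- The eigenvalues modulo 4

Σ≤-≡0-mod : ∀ {q} n f → (∀ ℓ → ℓ ≤ n → f ℓ ≡ + 0 mod q) → Σ≤ n f ≡ + 0 mod q
Σ≤-≡0-mod zero    f f≡0 = f≡0 0 z≤n
Σ≤-≡0-mod (suc n) f f≡0 = +-cong-mod (Σ≤-≡0-mod n f (λ ℓ ℓ≤n → f≡0 ℓ (ℕ.m≤n⇒m≤1+n ℓ≤n))) (f≡0 (suc n) ℕ.≤-refl)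

Σ≤-single-mod : ∀ {q} n f p → p ≤ n → (∀ ℓ → ℓ ≤ n → ℓ ≢ p → f ℓ ≡ + 0 mod q) → Σ≤ n f ≡ f p mod q
Σ≤-single-mod zero    f zero p≤n f≡0 = ≡mod-refl
Σ≤-single-mod (suc n) f p    p≤n f≡0 with p ℕ.≟ suc n
... | yes refl = ≡mod-trans (+-cong-mod (Σ≤-≡0-mod n f (λ ℓ ℓ≤n → f≡0 ℓ (ℕ.m≤n⇒m≤1+n ℓ≤n) (ℕ.<⇒≢ (s≤s ℓ≤n)))) ≡mod-refl)
                            (≡⇒≡mod (ℤ.+-identityˡ (f p)))
... | no p≢1+n = ≡mod-trans (+-cong-mod (Σ≤-single-mod n f p (ℕ.≤-pred (ℕ.≤∧≢⇒< p≤n p≢1+n)) (λ ℓ ℓ≤n → f≡0 ℓ (ℕ.m≤n⇒m≤1+n ℓ≤n)))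
                                        (f≡0 (suc n) ℕ.≤-refl (p≢1+n ∘ sym)))
                            (≡⇒≡mod (ℤ.+-identityʳ (f p)))

Σ≤-pair-mod : ∀ {q} n f p p′ → p < p′ → p′ ≤ n → (∀ ℓ → ℓ ≤ n → ℓ ≢ p → ℓ ≢ p′ → f ℓ ≡ + 0 mod q) →
              Σ≤ n f ≡ f p + f p′ mod q
Σ≤-pair-mod zero    f p zero    () z≤n _
Σ≤-pair-mod (suc n) f p p′ p<p′ p′≤n f≡0 with p′ ℕ.≟ suc n
... | yes refl = +-cong-mod (Σ≤-single-mod n f p (ℕ.≤-pred p<p′) (λ ℓ ℓ≤n ℓ≢p → f≡0 ℓ (ℕ.m≤n⇒m≤1+n ℓ≤n) ℓ≢p (ℕ.<⇒≢ (s≤s ℓ≤n))))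
                            ≡mod-refl
... | no p′≢1+n = ≡mod-trans (+-cong-mod (Σ≤-pair-mod n f p p′ p<p′ (ℕ.≤-pred (ℕ.≤∧≢⇒< p′≤n p′≢1+n)) (λ ℓ ℓ≤n → f≡0 ℓ (ℕ.m≤n⇒m≤1+n ℓ≤n)))
                                         (f≡0 (suc n) ℕ.≤-refl (ℕ.>⇒≢ (ℕ.<-≤-trans p<p′ p′≤n)) (p′≢1+n ∘ sym)))
                             (≡⇒≡mod (ℤ.+-identityʳ (f p + f p′)))

-- eig k i j unfolds definitionally to Σ≤ (k ∸ i) (term k i j).
term : ℕ → ℕ → ℕ → ℕ → ℤ
term k i j ℓ = sign ℓ * binom j ℓ * + (binomℤ (k ∸ j) ((+ i - + j) + + ℓ) ℕ.^ 2)

i-j+ℓ≡u : ∀ i j ℓ u → i ℕ.+ ℓ ≡ j ℕ.+ u → (+ i - + j) + + ℓ ≡ + u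
i-j+ℓ≡u i j ℓ u i+ℓ≡j+u = begin
    (+ i - + j) + + ℓ      ≡⟨ swap (+ i) (+ j) (+ ℓ) ⟩
    (+ i + + ℓ) - + j      ≡⟨ cong (_- + j) (trans (sym (ℤ.pos-+ i ℓ)) (trans (cong +_ i+ℓ≡j+u) (ℤ.pos-+ j u))) ⟩
    (+ j + + u) - + j      ≡⟨ cancel (+ j) (+ u) ⟩
    + u                    ∎
  where
    open ≡-Reasoning
    swap : ∀ a b c → (a - b) + c ≡ (a + c) - b
    swap = solve-∀
    cancel : ∀ a b → (a + b) - a ≡ b
    cancel = solve-∀

i-j+ℓ≡-[1+s] : ∀ i j ℓ s → i ℕ.+ ℓ ℕ.+ suc s ≡ j → (+ i - + j) + + ℓ ≡ -[1+ s ]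
i-j+ℓ≡-[1+s] i .(i ℕ.+ ℓ ℕ.+ suc s) ℓ s refl = begin
    (+ i - + (i ℕ.+ ℓ ℕ.+ suc s)) + + ℓ
  ≡⟨ cong (λ z → (+ i - z) + + ℓ) (trans (ℤ.pos-+ (i ℕ.+ ℓ) (suc s)) (cong (_+ + suc s) (ℤ.pos-+ i ℓ))) ⟩
    (+ i - ((+ i + + ℓ) + + suc s)) + + ℓ
  ≡⟨ cancel (+ i) (+ ℓ) (+ suc s) ⟩
    - + suc s ∎
  where
    open ≡-Reasoning
    cancel : ∀ a b c → (a - ((a + b) + c)) + b ≡ - c
    cancel = solve-∀

sq : ∀ y → + (y ℕ.^ 2) ≡ + y * + y
sq y = trans (cong (λ z → + (y ℕ.* z)) (ℕ.*-identityʳ y)) (ℤ.pos-* y y)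

term-≥ : ∀ k i j ℓ u → i ℕ.+ ℓ ≡ j ℕ.+ u → term k i j ℓ ≡ sign ℓ * binom j ℓ * (binom (k ∸ j) u * binom (k ∸ j) u)
term-≥ k i j ℓ u i+ℓ≡j+u =
  cong (λ z → sign ℓ * binom j ℓ * z) (trans (cong (λ z → + (binomℤ (k ∸ j) z ℕ.^ 2)) (i-j+ℓ≡u i j ℓ u i+ℓ≡j+u)) (sq ((k ∸ j) C u)))

term-< : ∀ k i j ℓ s → i ℕ.+ ℓ ℕ.+ suc s ≡ j → term k i j ℓ ≡ + 0
term-< k i j ℓ s i+ℓ<j =
  trans (cong (λ z → sign ℓ * binom j ℓ * + (binomℤ (k ∸ j) z ℕ.^ 2)) (i-j+ℓ≡-[1+s] i j ℓ s i+ℓ<j)) (ℤ.*-zeroʳ (sign ℓ * binom j ℓ))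

term-j<ℓ : ∀ k i j ℓ → j < ℓ → term k i j ℓ ≡ + 0
term-j<ℓ k i j ℓ j<ℓ =
  trans (cong (λ z → sign ℓ * + z * + (binomℤ (k ∸ j) ((+ i - + j) + + ℓ) ℕ.^ 2)) (k>n⇒nCk≡0 j<ℓ))
        (cong (_* + (binomℤ (k ∸ j) ((+ i - + j) + + ℓ) ℕ.^ 2)) (ℤ.*-zeroʳ (sign ℓ)))

sign-double : ∀ d → sign (double d) ≡ + 1
sign-double zero    = refl
sign-double (suc d) = trans (ℤ.neg-involutive (sign (double d))) (sign-double d)

eig-0 : ∀ k i → i ≤ k → eig k i 0 ≡ binom k i * binom k i mod 4
eig-0 k i i≤k = ≡mod-trans (Σ≤-single-mod (k ∸ i) (term k i 0) 0 z≤n vanish)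
                           (≡⇒≡mod (trans (term-≥ k i 0 0 i (ℕ.+-identityʳ i)) (ℤ.*-identityˡ _)))
  where
    vanish : ∀ ℓ → ℓ ≤ k ∸ i → ℓ ≢ 0 → term k i 0 ℓ ≡ + 0 mod 4
    vanish zero    _ ℓ≢0 = ⊥-elim (ℓ≢0 refl)
    vanish (suc ℓ) _ _   = ≡⇒≡mod (term-j<ℓ k i 0 (suc ℓ) (s≤s z≤n))

eig-1 : ∀ k i → i < k → eig (suc k) (suc i) 1 ≡ binom k i * binom k i - binom k (suc i) * binom k (suc i) mod 4
eig-1 k i i<k = ≡mod-trans (Σ≤-pair-mod (k ∸ i) (term (suc k) (suc i) 1) 0 1 (s≤s z≤n) (ℕ.m<n⇒0<n∸m i<k) vanish)
                           (≡⇒≡mod (cong₂ _+_ (trans (term-≥ (suc k) (suc i) 1 0 i (ℕ.+-identityʳ (suc i))) (ℤ.*-identityˡ _))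
                                             (trans (term-≥ (suc k) (suc i) 1 1 (suc i) (ℕ.+-comm (suc i) 1)) (neg-one (binom k (suc i) * binom k (suc i))))))
  where
    vanish : ∀ ℓ → ℓ ≤ k ∸ i → ℓ ≢ 0 → ℓ ≢ 1 → term (suc k) (suc i) 1 ℓ ≡ + 0 mod 4
    vanish zero          _ ℓ≢0 _   = ⊥-elim (ℓ≢0 refl)
    vanish (suc zero)    _ _   ℓ≢1 = ⊥-elim (ℓ≢1 refl)
    vanish (suc (suc ℓ)) _ _   _   = ≡⇒≡mod (term-j<ℓ (suc k) (suc i) 1 (suc (suc ℓ)) (s≤s (s≤s z≤n)))
    neg-one : ∀ x → - + 1 * + 1 * x ≡ - x
    neg-one = solve-∀

eig-k : ∀ k i d → i ≤ k → k ∸ i ≡ double d → eig k i k ≡ binom k i mod 4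
eig-k k i d i≤k k-i≡2d = ≡mod-trans (Σ≤-single-mod n (term k i k) n ℕ.≤-refl vanish) (≡⇒≡mod value)
  where
    n = k ∸ i
    vanish : ∀ ℓ → ℓ ≤ n → ℓ ≢ n → term k i k ℓ ≡ + 0 mod 4
    vanish ℓ ℓ≤n ℓ≢n = ≡⇒≡mod (term-< k i k ℓ (n ∸ suc ℓ) i+ℓ<k)
      where
        i+ℓ<k : i ℕ.+ ℓ ℕ.+ suc (n ∸ suc ℓ) ≡ k
        i+ℓ<k = trans (ℕ.+-assoc i ℓ _) (trans (cong (i ℕ.+_) (trans (ℕ.+-suc ℓ _) (ℕ.m+[n∸m]≡n (ℕ.≤∧≢⇒< ℓ≤n ℓ≢n)))) (ℕ.m+[n∸m]≡n i≤k))
    value : term k i k n ≡ binom k i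
    value = begin
        term k i k n                             ≡⟨ term-≥ k i k n 0 (trans (ℕ.m+[n∸m]≡n i≤k) (sym (ℕ.+-identityʳ k))) ⟩
        sign n * binom k n * (+ 1 * + 1)         ≡⟨ cong (λ z → z * binom k n * + 1) (trans (cong sign k-i≡2d) (sign-double d)) ⟩
        + 1 * binom k n * + 1                    ≡⟨ ℤ.*-identityʳ _ ⟩
        + 1 * binom k n                          ≡⟨ ℤ.*-identityˡ _ ⟩
        binom k n                                ≡⟨ cong +_ (nCk≡nC[n∸k] i≤k) ⟨
        binom k i                                ∎
      where open ≡-Reasoning

binom-complement : ∀ M r i m → i ℕ.+ r ≡ M ℕ.+ m → binom M r ≡ binom M ⟪ i ∸ m ⟫
binom-complement M r i m i+r≡M+m with m ℕ.≤? i
... | yes m≤i = begin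
    binom M r                 ≡⟨ cong +_ (nCk≡nC[n∸k] r≤M) ⟩
    binom M (M ∸ r)           ≡⟨ cong (λ z → binom M (z ∸ r)) M≡i₀+r ⟨
    binom M (i₀ ℕ.+ r ∸ r)    ≡⟨ cong (binom M) (ℕ.m+n∸n≡m i₀ r) ⟩
    binom M i₀                ≡⟨ ⟪+∸⟫ (binom M) m i₀ ⟨
    binom M ⟪ m ℕ.+ i₀ ∸ m ⟫  ≡⟨ cong (λ z → binom M ⟪ z ∸ m ⟫) (ℕ.m+[n∸m]≡n m≤i) ⟩
    binom M ⟪ i ∸ m ⟫         ∎
  where
    open ≡-Reasoning
    i₀ = i ∸ m
    M≡i₀+r : i₀ ℕ.+ r ≡ M
    M≡i₀+r = ℕ.+-cancelʳ-≡ m (i₀ ℕ.+ r) M (begin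
      i₀ ℕ.+ r ℕ.+ m     ≡⟨ ℕ.+-assoc i₀ r m ⟩
      i₀ ℕ.+ (r ℕ.+ m)   ≡⟨ cong (i₀ ℕ.+_) (ℕ.+-comm r m) ⟩
      i₀ ℕ.+ (m ℕ.+ r)   ≡⟨ ℕ.+-assoc i₀ m r ⟨
      i₀ ℕ.+ m ℕ.+ r     ≡⟨ cong (ℕ._+ r) (ℕ.m∸n+n≡m m≤i) ⟩
      i ℕ.+ r            ≡⟨ i+r≡M+m ⟩
      M ℕ.+ m            ∎)
    r≤M : r ≤ M
    r≤M = subst (r ≤_) M≡i₀+r (ℕ.m≤n+m r i₀)
... | no m≰i = trans (cong +_ (k>n⇒nCk≡0 M<r)) (sym (⟪∸⟫-< (binom M) (ℕ.≰⇒> m≰i)))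
  where
    M<r : M < r
    M<r = ℕ.+-cancelˡ-< i M r (subst₂ _<_ (ℕ.+-comm M i) (sym i+r≡M+m) (ℕ.+-monoʳ-< M (ℕ.≰⇒> m≰i)))

c*[y*y]≡0-mod-4 : ∀ c {y} → y ≡ + 0 mod 2 → c * (y * y) ≡ + 0 mod 4
c*[y*y]≡0-mod-4 c (quot q refl) = quot (c * q * q) (regroup c q)
  where regroup : ∀ c q → c * ((+ 0 + q * + 2) * (+ 0 + q * + 2)) ≡ + 0 + c * q * q * + 4
        regroup = solve-∀

eig-M : ∀ k i M e d → i ≤ k → k ≡ M ℕ.+ 2 ^ suc e → k ∸ i ≡ double d →
        eig k i M ≡ binom M i + binom M ⟪ i ∸ 2 ^ suc e ⟫ mod 4
eig-M k i M e d i≤k k≡M+m n≡2d = result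
  where
    m = 2 ^ suc e
    n = k ∸ i
    i+n≡M+m : i ℕ.+ n ≡ M ℕ.+ m
    i+n≡M+m = trans (ℕ.m+[n∸m]≡n i≤k) k≡M+m
    k∸M≡m : k ∸ M ≡ m
    k∸M≡m = trans (cong (_∸ M) k≡M+m) (ℕ.m+n∸m≡n M m)

    i+ℓ+t≡M+m : ∀ ℓ → ℓ ≤ n → i ℕ.+ ℓ ℕ.+ (n ∸ ℓ) ≡ M ℕ.+ m
    i+ℓ+t≡M+m ℓ ℓ≤n = trans (ℕ.+-assoc i ℓ (n ∸ ℓ)) (trans (cong (i ℕ.+_) (ℕ.m+[n∸m]≡n ℓ≤n)) i+n≡M+m)

    term≡binom : ∀ ℓ u → i ℕ.+ ℓ ≡ M ℕ.+ u → m C u ≡ 1 → sign ℓ ≡ + 1 → term k i M ℓ ≡ binom M ℓ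
    term≡binom ℓ u i+ℓ≡M+u mCu≡1 sign≡1 = begin
        term k i M ℓ                                               ≡⟨ term-≥ k i M ℓ u i+ℓ≡M+u ⟩
        sign ℓ * binom M ℓ * (binom (k ∸ M) u * binom (k ∸ M) u)   ≡⟨ cong (λ z → sign ℓ * binom M ℓ * (binom z u * binom z u)) k∸M≡m ⟩
        sign ℓ * binom M ℓ * (binom m u * binom m u)               ≡⟨ cong₂ (λ s c → s * binom M ℓ * (+ c * + c)) sign≡1 mCu≡1 ⟩
        + 1 * binom M ℓ * + 1                                      ≡⟨ ℤ.*-identityʳ _ ⟩
        + 1 * binom M ℓ                                            ≡⟨ ℤ.*-identityˡ _ ⟩
        binom M ℓ                                                  ∎
      where open ≡-Reasoning

    at-n : term k i M n ≡ binom M ⟪ i ∸ m ⟫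
    at-n = trans (term≡binom n m i+n≡M+m (nCn≡1 m) (trans (cong sign n≡2d) (sign-double d))) (binom-complement M n i m i+n≡M+m)

    at-n∸m : m ≤ n → term k i M (n ∸ m) ≡ binom M i
    at-n∸m m≤n = trans (term≡binom (n ∸ m) 0 i+[n∸m]≡M+0 refl sign≡1) (binom-complement M (n ∸ m) i 0 i+[n∸m]≡M+0)
      where
        i+[n∸m]≡M+0 : i ℕ.+ (n ∸ m) ≡ M ℕ.+ 0
        i+[n∸m]≡M+0 = ℕ.+-cancelʳ-≡ m _ _ (begin
          i ℕ.+ (n ∸ m) ℕ.+ m     ≡⟨ ℕ.+-assoc i (n ∸ m) m ⟩
          i ℕ.+ (n ∸ m ℕ.+ m)     ≡⟨ cong (i ℕ.+_) (ℕ.m∸n+n≡m m≤n) ⟩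
          i ℕ.+ n                 ≡⟨ i+n≡M+m ⟩
          M ℕ.+ m                 ≡⟨ cong (ℕ._+ m) (ℕ.+-identityʳ M) ⟨
          M ℕ.+ 0 ℕ.+ m           ∎)
          where open ≡-Reasoning
        sign≡1 : sign (n ∸ m) ≡ + 1
        sign≡1 = trans (cong sign (trans (cong₂ _∸_ n≡2d (2^[1+e]≡double[2^e] e)) (double-∸ d (2 ^ e)))) (sign-double (d ∸ 2 ^ e))

    vanish : ∀ ℓ → ℓ ≤ n → ℓ ≢ n → ℓ ℕ.+ m ≢ n → term k i M ℓ ≡ + 0 mod 4
    vanish ℓ ℓ≤n ℓ≢n ℓ+m≢n with ℕ.<-cmp (n ∸ ℓ) m
    ... | tri< t<m _ _ = ≡mod-trans (≡⇒≡mod (trans (term-≥ k i M ℓ u i+ℓ≡M+u) (cong (λ z → sign ℓ * binom M ℓ * (binom z u * binom z u)) k∸M≡m)))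
                                    (c*[y*y]≡0-mod-4 (sign ℓ * binom M ℓ) (2^eCr≡0-mod-2 (suc e) (ℕ.m<n⇒0<n∸m t<m) u<m))
      where
        t = n ∸ ℓ
        u = m ∸ t
        u<m : u < m
        u<m = ℕ.∸-monoʳ-< {m} {t} {0} (ℕ.m<n⇒0<n∸m (ℕ.≤∧≢⇒< ℓ≤n ℓ≢n)) (ℕ.<⇒≤ t<m)
        i+ℓ≡M+u : i ℕ.+ ℓ ≡ M ℕ.+ u
        i+ℓ≡M+u = ℕ.+-cancelʳ-≡ t _ _ (trans (i+ℓ+t≡M+m ℓ ℓ≤n)
                    (trans (cong (M ℕ.+_) (sym (ℕ.m∸n+n≡m (ℕ.<⇒≤ t<m)))) (sym (ℕ.+-assoc M u t))))
    ... | tri≈ _ t≡m _ = ⊥-elim (ℓ+m≢n (trans (cong (ℓ ℕ.+_) (sym t≡m)) (ℕ.m+[n∸m]≡n ℓ≤n)))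
    ... | tri> _ _ m<t = ≡⇒≡mod (term-< k i M ℓ s i+ℓ+1+s≡M)
      where
        t = n ∸ ℓ
        s = t ∸ suc m
        i+ℓ+1+s≡M : i ℕ.+ ℓ ℕ.+ suc s ≡ M
        i+ℓ+1+s≡M = ℕ.+-cancelʳ-≡ m _ _ (begin
          i ℕ.+ ℓ ℕ.+ suc s ℕ.+ m       ≡⟨ ℕ.+-assoc (i ℕ.+ ℓ) (suc s) m ⟩
          i ℕ.+ ℓ ℕ.+ (suc s ℕ.+ m)     ≡⟨ cong (i ℕ.+ ℓ ℕ.+_) (trans (ℕ.+-comm (suc s) m) (trans (ℕ.+-suc m s) (ℕ.m+[n∸m]≡n m<t))) ⟩
          i ℕ.+ ℓ ℕ.+ t                 ≡⟨ i+ℓ+t≡M+m ℓ ℓ≤n ⟩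
          M ℕ.+ m                       ∎)
          where open ≡-Reasoning

    result : eig k i M ≡ binom M i + binom M ⟪ i ∸ m ⟫ mod 4
    result with m ℕ.≤? n
    ... | yes m≤n = ≡mod-trans (Σ≤-pair-mod n (term k i M) (n ∸ m) n (ℕ.∸-monoʳ-< {n} {m} {0} 0<m m≤n) ℕ.≤-refl vanish′)
                               (≡⇒≡mod (cong₂ _+_ (at-n∸m m≤n) at-n))
      where
        0<m : 0 < m
        0<m = ℕ.m^n>0 2 (suc e)
        vanish′ : ∀ ℓ → ℓ ≤ n → ℓ ≢ n ∸ m → ℓ ≢ n → term k i M ℓ ≡ + 0 mod 4
        vanish′ ℓ ℓ≤n ℓ≢n∸m ℓ≢n = vanish ℓ ℓ≤n ℓ≢n (λ ℓ+m≡n → ℓ≢n∸m (trans (sym (ℕ.m+n∸n≡m ℓ m)) (cong (_∸ m) ℓ+m≡n)))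
    ... | no m≰n = ≡mod-trans (Σ≤-single-mod n (term k i M) n ℕ.≤-refl vanish′)
                              (≡⇒≡mod (trans at-n (sym (trans (cong (_+ binom M ⟪ i ∸ m ⟫) M<i) (ℤ.+-identityˡ _)))))
      where
        vanish′ : ∀ ℓ → ℓ ≤ n → ℓ ≢ n → term k i M ℓ ≡ + 0 mod 4
        vanish′ ℓ ℓ≤n ℓ≢n = vanish ℓ ℓ≤n ℓ≢n (λ ℓ+m≡n → m≰n (subst (m ≤_) ℓ+m≡n (ℕ.m≤n+m m ℓ)))
        M<i : binom M i ≡ + 0
        M<i = trans (binom-complement M i n m (trans (ℕ.+-comm n i) i+n≡M+m)) (⟪∸⟫-< (binom M) (ℕ.≰⇒> m≰n))

SameParity⇒∸-even : ∀ {n r} → SameParity n r → Σ ℕ λ d → n ∸ r ≡ double d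
SameParity⇒∸-even (both-even a b) = a ∸ b , double-∸ a b
SameParity⇒∸-even (both-odd a b)  = a ∸ b , double-∸ a b

eig-0-1≡2-mod-4 : ∀ k i → i < k → binom (suc k) (suc i) ≡ + 1 mod 2 → binom k (suc i) ≡ + 1 mod 2 →
                  eig (suc k) (suc i) 0 - eig (suc k) (suc i) 1 ≡ + 2 mod 4
eig-0-1≡2-mod-4 k i i<k c-odd b-odd = begin
    eig (suc k) (suc i) 0 - eig (suc k) (suc i) 1
  ≈⟨ -cong-mod (eig-0 (suc k) (suc i) (ℕ.m≤n⇒m≤1+n i<k)) (eig-1 k i i<k) ⟩
    c * c - (a * a - b * b)
  ≡⟨ cong (λ z → z * z - (a * a - b * b)) (binom-pascal k i) ⟩
    (a + b) * (a + b) - (a * a - b * b)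
  ≡⟨ regroup a b ⟩
    + 2 * (b * (a + b))
  ≡⟨ cong (λ z → + 2 * (b * z)) (binom-pascal k i) ⟨
    + 2 * (b * c)
  ≈⟨ *-scale-mod 2 (*-cong-mod b-odd c-odd) ⟩
    + 2 ∎
  where
    open ≡mod-Reasoning 4
    a = binom k i
    b = binom k (suc i)
    c = binom (suc k) (suc i)
    regroup : ∀ a b → (a + b) * (a + b) - (a * a - b * b) ≡ + 2 * (b * (a + b))
    regroup = solve-∀

eig-0-k≡2-mod-4 : ∀ k i d → i ≤ k → k ∸ i ≡ double d → binom k i ≡ + 3 mod 4 → eig k i 0 - eig k i k ≡ + 2 mod 4
eig-0-k≡2-mod-4 k i d i≤k k-i≡2d c≡3 = begin
    eig k i 0 - eig k i k             ≈⟨ -cong-mod (eig-0 k i i≤k) (eig-k k i d i≤k k-i≡2d) ⟩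
    binom k i * binom k i - binom k i ≈⟨ -cong-mod (*-cong-mod c≡3 c≡3) c≡3 ⟩
    + 3 * + 3 - + 3                   ≈⟨ quot (+ 1) refl ⟩
    + 2                               ∎
  where open ≡mod-Reasoning 4

eig-0-M≡2-mod-4 : ∀ k i d → i ≤ k → k ∸ i ≡ double d → binom k i ≡ + 1 mod 4 → (s : Split≡3 k i) →
                  eig k i 0 - eig k i (Split≡3.M s) ≡ + 2 mod 4
eig-0-M≡2-mod-4 k i d i≤k k-i≡2d c≡1 (split e M k≡M+m M≡3) = begin
    eig k i 0 - eig k i M
  ≈⟨ -cong-mod (eig-0 k i i≤k) (eig-M k i M e d i≤k k≡M+m k-i≡2d) ⟩
    binom k i * binom k i - (binom M i + binom M ⟪ i ∸ 2 ^ suc e ⟫)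
  ≈⟨ -cong-mod (*-cong-mod c≡1 c≡1) M≡3 ⟩
    + 1 * + 1 - + 3
  ≈⟨ quot (- + 1) refl ⟩
    + 2 ∎
  where open ≡mod-Reasoning 4

Split≡3-M≤n : ∀ {n r} (s : Split≡3 n r) → Split≡3.M s ≤ n
Split≡3-M≤n (split e M n≡M+m _) = subst (M ≤_) (sym n≡M+m) (ℕ.m≤m+n M _)

eig-gap≡2-mod-4 : ∀ k i → i < k → binom (suc k) (suc i) ≡ + 1 mod 2 →
                  Σ ℕ λ j → j ≤ suc k × eig (suc k) (suc i) 0 - eig (suc k) (suc i) j ≡ + 2 mod 4
eig-gap≡2-mod-4 k i i<k c-odd with even-or-odd (k C suc i)
... | inj₂ b-odd  = 1 , s≤s z≤n , eig-0-1≡2-mod-4 k i i<k c-odd b-odd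
... | inj₁ b-even with SameParity⇒∸-even (same-parity (suc k) (suc i) c-odd b-even)
                     | odd⇒≡1⊎≡3-mod-4 (suc k C suc i) c-odd
...   | d , k-i≡2d | inj₂ c≡3 = suc k , ℕ.≤-refl , eig-0-k≡2-mod-4 (suc k) (suc i) d (ℕ.m≤n⇒m≤1+n i<k) k-i≡2d c≡3
...   | d , k-i≡2d | inj₁ c≡1 = Split≡3.M s , Split≡3-M≤n s , eig-0-M≡2-mod-4 (suc k) (suc i) d (ℕ.m≤n⇒m≤1+n i<k) k-i≡2d c≡1 s
  where
    s : Split≡3 (suc k) (suc i)
    s = split≡3 (suc k) (suc i) (<-wellFounded (suc k)) (s≤s i<k) c≡1 b-even

foldr-gcd-∣ : ∀ {x xs} → x ∈ xs → foldr gcd 0 xs ∣ x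
foldr-gcd-∣ {xs = x ∷ _}  (here refl)  = gcd[m,n]∣m x _
foldr-gcd-∣ {xs = y ∷ ys} (there x∈ys) = ∣-trans (gcd[m,n]∣n y (foldr gcd 0 ys)) (foldr-gcd-∣ x∈ys)

α∣eig-gap : ∀ k i j → j ≤ k → α k i ∣ ∣ eig k i 0 - eig k i j ∣
α∣eig-gap k i j j≤k = foldr-gcd-∣ (∈-map⁺ (λ j → ∣ eig k i 0 - eig k i j ∣) (∈-upTo⁺ (s≤s j≤k)))

∣∣x∣⇒x≡0-mod : ∀ {m} x → m ∣ ∣ x ∣ → x ≡ + 0 mod m
∣∣x∣⇒x≡0-mod {m} x m∣x with ∣ᵤ⇒∣ {+ m} {x} m∣x
... | divides q x≡q*m = quot q (trans x≡q*m (sym (ℤ.+-identityˡ (q * + m))))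

lemma3p11 : (k i : ℕ) → 2 ≤ k → 1 ≤ i → i < k →
    (k C i) % 2 ≡ 1 → ord₂≤1 (α k i)
lemma3p11 (suc k) (suc i) _ _ (s≤s i<k) c%2≡1 4∣α with eig-gap≡2-mod-4 k i i<k c-odd
  where
    c-odd : binom (suc k) (suc i) ≡ + 1 mod 2
    c-odd = subst (λ r → binom (suc k) (suc i) ≡ + r mod 2) c%2≡1 (≡%-mod (suc k C suc i) 2)
... | j , j≤k , gap≡2 =
  ¬2≡0-mod-4 (≡mod-trans (≡mod-sym gap≡2) (∣∣x∣⇒x≡0-mod _ (∣-trans 4∣α (α∣eig-gap (suc k) (suc i) j j≤k))))
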